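{- Let $k\le n$ be positive integers, let $g$ be a monic polynomial of degree $d$ over $\mathbb{F}_q$, and let $\mathcal{I}=(g,\ldots,g)$ be the $k$-tuple with all entries $g$. Then $\mu_q(n,k,d;\mathcal{I})=1$.
   Context: For positive integers $k\le n$ and $d\ge0$, $M_q(n,k,d)$ is the set of $n\times k$ matrices over $\mathbb{F}_q[x]$ of the form $x^dI+x^{d-1}C_{d-1}+\cdots+C_0$ with $C_i\in M_{n,k}(\mathbb{F}_q)$, where $I$ is the $n\times k$ matrix with $(i,j)$ entry $1$ if $i=j$ and $0$ otherwise. Each $P\in M_q(n,k,d)$ is equivalent (i.e. $APB$ for invertible $A\in M_n(\mathbb{F}_q[x])$, $B\in M_k(\mathbb{F}_q[x])$) to a unique $\mathrm{diag}_{n,k}(p_1,\ldots,p_k)$ with $p_i$ monic and $p_i\mid p_{i+1}$ (Smith normal form); $(p_1,\ldots,p_k)$ are the invariant factors of $P$. $\mu_q(n,k,d;\mathcal{I})$ is the number of $P\in M_q(n,k,d)$ with invariant factors $\mathcal{I}$. -}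

module Defs where

open import Data.Nat as ℕ using (ℕ; zero; suc; _<_; _≤_)
open import Data.Fin using (Fin; toℕ; fromℕ<)
open import Data.List using (List; []; _∷_; _++_; tabulate)
open import Data.Product using (Σ; ∃; _×_; _,_)
open import Data.Bool using (if_then_else_)
open import Relation.Nullary using (¬_)
open import Relation.Nullary.Decidable using (does)
open import Relation.Binary.PropositionalEquality using (_≡_)
open import Algebra.Structures using (IsCommutativeRing)
open import Function.Bundles using (_↔_)

record FiniteField : Set₁ where
  infixl 6 _+_
  infixl 7 _*_
  field
    Carrier    : Set
    _+_ _*_    : Carrier → Carrier → Carrier
    -_         : Carrier → Carrier
    0# 1#      : Carrier
    isCommRing : IsCommutativeRing _≡_ _+_ _*_ -_ 0# 1#
    0≢1        : ¬ (0# ≡ 1#)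
    inverse    : ∀ x → ¬ (x ≡ 0#) → ∃ λ y → x * y ≡ 1#
    q          : ℕ
    enum       : Fin q ↔ Carrier

module _ (F : FiniteField) where
  open FiniteField F

  -- Polynomials in F[x] as coefficient lists (constant term first).
  -- Equality of polynomials is coefficientwise (trailing zeros irrelevant).
  Poly : Set
  Poly = List Carrier

  coeff : Poly → ℕ → Carrier
  coeff []       _       = 0#
  coeff (a ∷ p)  zero    = a
  coeff (a ∷ p)  (suc i) = coeff p i

  _≈ₚ_ : Poly → Poly → Set
  p ≈ₚ r = ∀ i → coeff p i ≡ coeff r i

  _+ₚ_ : Poly → Poly → Poly
  []      +ₚ r       = r
  (a ∷ p) +ₚ []      = a ∷ p
  (a ∷ p) +ₚ (b ∷ r) = (a + b) ∷ (p +ₚ r)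

  scale : Carrier → Poly → Poly
  scale a []      = []
  scale a (b ∷ p) = (a * b) ∷ scale a p

  _*ₚ_ : Poly → Poly → Poly
  []      *ₚ r = []
  (a ∷ p) *ₚ r = scale a r +ₚ (0# ∷ (p *ₚ r))

  _∣ₚ_ : Poly → Poly → Set
  p ∣ₚ r = ∃ λ s → (s *ₚ p) ≈ₚ r

  MonicOfDegree : Poly → ℕ → Set
  MonicOfDegree p d = (coeff p d ≡ 1#) × (∀ j → d < j → coeff p j ≡ 0#)

  Monic : Poly → Set
  Monic p = ∃ λ d → MonicOfDegree p d

  PMat : ℕ → ℕ → Set
  PMat m l = Fin m → Fin l → Poly

  _≈ₘ_ : ∀ {m l} → PMat m l → PMat m l → Set
  A ≈ₘ B = ∀ i j → A i j ≈ₚ B i j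

  sumFin : ∀ {m} → (Fin m → Poly) → Poly
  sumFin {zero}  f = []
  sumFin {suc m} f = f Fin.zero +ₚ sumFin (λ i → f (Fin.suc i))

  _*ₘ_ : ∀ {m l r} → PMat m l → PMat l r → PMat m r
  (A *ₘ B) i j = sumFin (λ t → A i t *ₚ B t j)

  diagₘ : ∀ m l → (Fin l → Poly) → PMat m l
  diagₘ m l p i j = if does (toℕ i ℕ.≟ toℕ j) then p j else []

  idₘ : ∀ m l → PMat m l
  idₘ m l = diagₘ m l (λ _ → 1# ∷ [])

  Invertible : ∀ {m} → PMat m m → Set
  Invertible {m} A = ∃ λ A' → ((A *ₘ A') ≈ₘ idₘ m m) × ((A' *ₘ A) ≈ₘ idₘ m m)

  Equivalent : ∀ {m l} → PMat m l → PMat m l → Set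
  Equivalent {m} {l} P Q =
    Σ (PMat m m) λ A → Σ (PMat l l) λ B →
      Invertible A × Invertible B × (((A *ₘ P) *ₘ B) ≈ₘ Q)

  -- (p_1,…,p_l) are the invariant factors of P: P is equivalent to
  -- diag(p_1,…,p_l) with p_i monic and p_i ∣ p_{i+1}
  -- (well-defined by uniqueness of the Smith normal form).
  HasInvariantFactors : ∀ {m l} → PMat m l → (Fin l → Poly) → Set
  HasInvariantFactors {m} {l} P ps =
    (∀ i → Monic (ps i)) ×
    (∀ (i : Fin l) (h : suc (toℕ i) < l) → ps i ∣ₚ ps (fromℕ< h)) ×
    Equivalent P (diagₘ m l ps)

  -- Elements of M_q(n,k,d): determined by (C_0,…,C_{d-1}), C_t ∈ M_{n,k}(F_q)
  Coeffs : ℕ → ℕ → ℕ → Set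
  Coeffs n k d = Fin d → Fin n → Fin k → Carrier

  -- the polynomial matrix x^d I + x^{d-1} C_{d-1} + ⋯ + C_0
  toPMat : ∀ {n k d} → Coeffs n k d → PMat n k
  toPMat {n} {k} {d} C i j =
    tabulate (λ t → C t i j) ++
      ((if does (toℕ i ℕ.≟ toℕ j) then 1# else 0#) ∷ [])

  -- μ_q(n,k,d;𝓘) = 1 : exactly one element of M_q(n,k,d) has invariant factors 𝓘
  ExactlyOneWithInvFactors : ∀ n k d → (Fin k → Poly) → Set
  ExactlyOneWithInvFactors n k d ps =
    Σ (Coeffs n k d) λ C →
      HasInvariantFactors (toPMat C) ps ×
      (∀ (C' : Coeffs n k d) → HasInvariantFactors (toPMat C') ps →
         ∀ t i j → C' t i j ≡ C t i j)

-- Existence: writing g = Σ gₜ xᵗ, the coefficient matrices Cₜ = gₜ I give x^d I + ⋯ + C₀ = g I,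
-- which is diag(g, …, g).  Uniqueness: if P is equivalent to g I, then P = A (g I) B for some
-- polynomial matrices A, B, so g divides every entry of P.  An entry of P has degree ≤ d = deg g,
-- so as a multiple of the monic g it is its own x^d-coefficient times g; that coefficient is the
-- corresponding entry of I.  Hence P = g I, which determines C₀, …, C_{d-1}.
module Submission where

open import Defs
open import Level using (_⊔_)
open import Data.Nat as ℕ using (ℕ; zero; suc; _≤_; s≤s)
import Data.Nat.Properties as ℕ
open import Data.Fin using (Fin; zero; suc; toℕ; fromℕ<)
import Data.Fin.Properties as Fin
open import Data.List using ([]; _∷_; _++_; tabulate)
open import Data.Bool using (true; false; if_then_else_)
open import Data.Product using (_,_; proj₁; proj₂)
open import Relation.Nullary using (does)
open import Relation.Binary.Definitions using (tri<; tri≈; tri>)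
open import Relation.Binary.Bundles using (Setoid)
import Relation.Binary.PropositionalEquality as ≡
open ≡ using (_≡_; module ≡-Reasoning)
import Relation.Binary.Reasoning.Setoid as SetoidReasoning
open import Algebra.Bundles using (CommutativeMonoid; CommutativeSemiring)
open import Algebra.Structures using (IsCommutativeRing; IsCommutativeMonoid)
import Algebra.Structures.Biased as Biased
import Algebra.Properties.CommutativeSemigroup as CommSemigroupProperties
import Algebra.Properties.CommutativeSemigroup.Divisibility as CommSemigroupDivisibility
import Algebra.Properties.Semiring.Divisibility as SemiringDivisibility
import Algebra.Properties.Semiring.Sum as SemiringSum

module Matrices {c ℓ} (R : CommutativeSemiring c ℓ) where
  open CommutativeSemiring R hiding (zero)
  open SemiringSum semiring public using (sum)
  open SemiringSum semiring using (sum-cong-≋; sum-replicate-zero; ∑-comm; *-distribˡ-sum; *-distribʳ-sum)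
  open CommSemigroupDivisibility *-commutativeSemigroup using (_∣_; _,_; ∣-respʳ-≈; x∣ʳy⇒x∣ʳzy; ∣ʳ-trans; x∣xy)
  open SemiringDivisibility semiring using (∣-refl; _∣0)

  private
    variable
      m l r s : ℕ

  Matrix : ℕ → ℕ → Set c
  Matrix m l = Fin m → Fin l → Carrier

  infix  4 _≋_
  infixl 7 _·_
  infix  4 _∣ₘ_

  _≋_ : Matrix m l → Matrix m l → Set ℓ
  A ≋ B = ∀ i j → A i j ≈ B i j

  ≋-setoid : ℕ → ℕ → Setoid c ℓ
  ≋-setoid m l = record
    { Carrier       = Matrix m l
    ; _≈_           = _≋_
    ; isEquivalence = record
      { refl  = λ i j → refl
      ; sym   = λ A≋B i j → sym (A≋B i j)
      ; trans = λ A≋B B≋C i j → trans (A≋B i j) (B≋C i j)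
      }
    }

  ≋-sym : {A B : Matrix m l} → A ≋ B → B ≋ A
  ≋-sym = Setoid.sym (≋-setoid _ _)

  ≋-trans : {A B C : Matrix m l} → A ≋ B → B ≋ C → A ≋ C
  ≋-trans = Setoid.trans (≋-setoid _ _)

  _·_ : Matrix m l → Matrix l r → Matrix m r
  (A · B) i j = sum λ t → A i t * B t j

  diag : Carrier → Matrix m l
  diag x i j = if does (toℕ i ℕ.≟ toℕ j) then x else 0#

  I : Matrix m m
  I = diag 1#

  ·-congˡ : (A : Matrix m l) {B B′ : Matrix l r} → B ≋ B′ → A · B ≋ A · B′
  ·-congˡ A B≋B′ i j = sum-cong-≋ λ t → *-congˡ (B≋B′ t j)

  ·-congʳ : (B : Matrix l r) {A A′ : Matrix m l} → A ≋ A′ → A · B ≋ A′ · B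
  ·-congʳ B A≋A′ i j = sum-cong-≋ λ t → *-congʳ (A≋A′ i t)

  ·-assoc : (A : Matrix m l) (B : Matrix l r) (C : Matrix r s) → (A · B) · C ≋ A · (B · C)
  ·-assoc A B C i k = begin
    sum (λ j → sum (λ t → A i t * B t j) * C j k)
      ≈⟨ sum-cong-≋ (λ j → *-distribʳ-sum (C j k) (λ t → A i t * B t j)) ⟩
    sum (λ j → sum (λ t → (A i t * B t j) * C j k))
      ≈⟨ sum-cong-≋ (λ j → sum-cong-≋ λ t → *-assoc (A i t) (B t j) (C j k)) ⟩
    sum (λ j → sum (λ t → A i t * (B t j * C j k)))
      ≈⟨ ∑-comm (λ j t → A i t * (B t j * C j k)) ⟩
    sum (λ t → sum (λ j → A i t * (B t j * C j k)))
      ≈⟨ sum-cong-≋ (λ t → sym (*-distribˡ-sum (A i t) (λ j → B t j * C j k))) ⟩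
    sum (λ t → A i t * sum (λ j → B t j * C j k))
      ∎
    where open SetoidReasoning setoid

  sum-≈0 : {f : Fin m → Carrier} → (∀ t → f t ≈ 0#) → sum f ≈ 0#
  sum-≈0 {m} f≈0 = trans (sum-cong-≋ f≈0) (sum-replicate-zero m)

  sum-I*ˡ : ∀ (i : Fin m) f → sum (λ t → I i t * f t) ≈ f i
  sum-I*ˡ zero f = begin
    1# * f zero + sum (λ t → 0# * f (suc t))  ≈⟨ +-cong (*-identityˡ (f zero)) (sum-≈0 (λ t → zeroˡ (f (suc t)))) ⟩
    f zero + 0#                               ≈⟨ +-identityʳ (f zero) ⟩
    f zero                                    ∎
    where open SetoidReasoning setoid
  sum-I*ˡ (suc i) f = trans (+-cong (zeroˡ (f zero)) (sum-I*ˡ i (λ t → f (suc t)))) (+-identityˡ (f (suc i)))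

  sum-*Iʳ : ∀ (j : Fin m) f → sum (λ t → f t * I t j) ≈ f j
  sum-*Iʳ zero f = begin
    f zero * 1# + sum (λ t → f (suc t) * 0#)  ≈⟨ +-cong (*-identityʳ (f zero)) (sum-≈0 (λ t → zeroʳ (f (suc t)))) ⟩
    f zero + 0#                               ≈⟨ +-identityʳ (f zero) ⟩
    f zero                                    ∎
    where open SetoidReasoning setoid
  sum-*Iʳ (suc j) f = trans (+-cong (zeroʳ (f zero)) (sum-*Iʳ j (λ t → f (suc t)))) (+-identityˡ (f (suc j)))

  ·-identityˡ : (A : Matrix m l) → I · A ≋ A
  ·-identityˡ A i j = sum-I*ˡ i (λ t → A t j)

  ·-identityʳ : (A : Matrix m l) → A · I ≋ A
  ·-identityʳ A i j = sum-*Iʳ j (λ t → A i t)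

  _∣ₘ_ : Carrier → Matrix m l → Set (c ⊔ ℓ)
  g ∣ₘ A = ∀ i j → g ∣ A i j

  ∣-+ : ∀ {g x y} → g ∣ x → g ∣ y → g ∣ x + y
  ∣-+ (p , p*g≈x) (q , q*g≈y) = p + q , trans (distribʳ _ p q) (+-cong p*g≈x q*g≈y)

  ∣-sum : ∀ {g} {f : Fin m → Carrier} → (∀ t → g ∣ f t) → g ∣ sum f
  ∣-sum {ℕ.zero}  _   = _ ∣0
  ∣-sum {ℕ.suc m} g∣f = ∣-+ (g∣f zero) (∣-sum λ t → g∣f (suc t))

  ∣ₘ-resp-≋ : ∀ {g} {A B : Matrix m l} → A ≋ B → g ∣ₘ A → g ∣ₘ B
  ∣ₘ-resp-≋ A≋B g∣A i j = ∣-respʳ-≈ (A≋B i j) (g∣A i j)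

  ∣ₘ-·ˡ : ∀ {g} (A : Matrix m l) {B : Matrix l r} → g ∣ₘ B → g ∣ₘ A · B
  ∣ₘ-·ˡ A g∣B i j = ∣-sum λ t → x∣ʳy⇒x∣ʳzy (A i t) (g∣B t j)

  ∣ₘ-·ʳ : ∀ {g} {A : Matrix m l} → g ∣ₘ A → (B : Matrix l r) → g ∣ₘ A · B
  ∣ₘ-·ʳ {A = A} g∣A B i j = ∣-sum λ t → ∣ʳ-trans (g∣A i t) (x∣xy (A i t) (B t j))

  ∣ₘ-diag : ∀ g → g ∣ₘ diag {m} {l} g
  ∣ₘ-diag g i j with does (toℕ i ℕ.≟ toℕ j)
  ... | true  = ∣-refl
  ... | false = g ∣0

  ∣ₘ-equivalent : ∀ {g} {P Q : Matrix m l} {A A′ : Matrix m m} {B B′ : Matrix l l} →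
                  A′ · A ≋ I → B · B′ ≋ I → (A · P) · B ≋ Q → g ∣ₘ Q → g ∣ₘ P
  ∣ₘ-equivalent {P = P} {Q} {A} {A′} {B} {B′} A′A≋I BB′≋I APB≋Q g∣Q =
    ∣ₘ-resp-≋ A′QB′≋P (∣ₘ-·ʳ (∣ₘ-·ˡ A′ g∣Q) B′)
    where
    open SetoidReasoning (≋-setoid _ _)
    A′QB′≋P : (A′ · Q) · B′ ≋ P
    A′QB′≋P = begin
      (A′ · Q) · B′              ≈⟨ ·-congʳ B′ (·-congˡ A′ (≋-sym APB≋Q)) ⟩
      (A′ · ((A · P) · B)) · B′  ≈⟨ ·-congʳ B′ (·-congˡ A′ (·-assoc A P B)) ⟩
      (A′ · (A · (P · B))) · B′  ≈⟨ ·-congʳ B′ (≋-sym (·-assoc A′ A (P · B))) ⟩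
      ((A′ · A) · (P · B)) · B′  ≈⟨ ·-congʳ B′ (·-congʳ (P · B) A′A≋I) ⟩
      (I · (P · B)) · B′         ≈⟨ ·-congʳ B′ (·-identityˡ (P · B)) ⟩
      (P · B) · B′               ≈⟨ ·-assoc P B B′ ⟩
      P · (B · B′)               ≈⟨ ·-congˡ P BB′≋I ⟩
      P · I                      ≈⟨ ·-identityʳ P ⟩
      P                          ∎

module Polynomials (F : FiniteField) where
  open ≡ using (refl; sym; trans; cong; cong₂)
  open FiniteField F
  private module K = IsCommutativeRing isCommRing

  infix  4 _≈_
  infixl 6 _⊕_
  infixl 7 _⊗_

  _⊕_ _⊗_ : Poly F → Poly F → Poly F
  _⊕_ = _+ₚ_ F
  _⊗_ = _*ₚ_ F

  𝟙 : Poly F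
  𝟙 = 1# ∷ []

  -- _≈ₚ_ as a record type, so that both sides of an equation can be inferred.
  record _≈_ (p r : Poly F) : Set where
    constructor mk≈
    field coeff-≈ : ∀ i → coeff F p i ≡ coeff F r i
  open _≈_ public

  ≈-setoid : Setoid _ _
  ≈-setoid = record
    { Carrier       = Poly F
    ; _≈_           = _≈_
    ; isEquivalence = record
      { refl  = mk≈ λ _ → refl
      ; sym   = λ p≈r → mk≈ λ i → sym (coeff-≈ p≈r i)
      ; trans = λ p≈r r≈s → mk≈ λ i → trans (coeff-≈ p≈r i) (coeff-≈ r≈s i)
      }
    }

  open Biased _≈_ using (isCommutativeMonoidˡ; isCommutativeSemiringˡ)
  open Setoid ≈-setoid public using () renaming (refl to ≈-refl; reflexive to ≈-reflexive; sym to ≈-sym; trans to ≈-trans)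

  coeff-⊕ : ∀ p r i → coeff F (p ⊕ r) i ≡ coeff F p i + coeff F r i
  coeff-⊕ []      r       i       = sym (K.+-identityˡ _)
  coeff-⊕ (a ∷ p) []      i       = sym (K.+-identityʳ _)
  coeff-⊕ (a ∷ p) (b ∷ r) zero    = refl
  coeff-⊕ (a ∷ p) (b ∷ r) (suc i) = coeff-⊕ p r i

  coeff-scale : ∀ a p i → coeff F (scale F a p) i ≡ a * coeff F p i
  coeff-scale a []      i       = sym (K.zeroʳ a)
  coeff-scale a (b ∷ p) zero    = refl
  coeff-scale a (b ∷ p) (suc i) = coeff-scale a p i

  ∷-cong : ∀ {a b p r} → a ≡ b → p ≈ r → a ∷ p ≈ b ∷ r
  ∷-cong a≡b p≈r = mk≈ λ where
    zero    → a≡b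
    (suc i) → coeff-≈ p≈r i

  ∷-≈[] : ∀ {a p} → a ≡ 0# → p ≈ [] → a ∷ p ≈ []
  ∷-≈[] a≡0 p≈[] = mk≈ λ where
    zero    → a≡0
    (suc i) → coeff-≈ p≈[] i

  ⊕-cong : ∀ {p p′ r r′} → p ≈ p′ → r ≈ r′ → p ⊕ r ≈ p′ ⊕ r′
  ⊕-cong {p} {p′} {r} {r′} p≈p′ r≈r′ = mk≈ λ i →
    trans (coeff-⊕ p r i) (trans (cong₂ _+_ (coeff-≈ p≈p′ i) (coeff-≈ r≈r′ i)) (sym (coeff-⊕ p′ r′ i)))

  ⊕-assoc : ∀ p q r → (p ⊕ q) ⊕ r ≈ p ⊕ (q ⊕ r)
  ⊕-assoc []      q       r       = ≈-refl
  ⊕-assoc (a ∷ p) []      r       = ≈-refl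
  ⊕-assoc (a ∷ p) (b ∷ q) []      = ≈-refl
  ⊕-assoc (a ∷ p) (b ∷ q) (c ∷ r) = ∷-cong (K.+-assoc a b c) (⊕-assoc p q r)

  ⊕-identityʳ : ∀ p → p ⊕ [] ≈ p
  ⊕-identityʳ []      = ≈-refl
  ⊕-identityʳ (a ∷ p) = ≈-refl

  ⊕-comm : ∀ p r → p ⊕ r ≈ r ⊕ p
  ⊕-comm []      r       = ≈-sym (⊕-identityʳ r)
  ⊕-comm (a ∷ p) []      = ≈-refl
  ⊕-comm (a ∷ p) (b ∷ r) = ∷-cong (K.+-comm a b) (⊕-comm p r)

  ⊕-commutativeMonoid : CommutativeMonoid _ _
  ⊕-commutativeMonoid = record
    { isCommutativeMonoid = isCommutativeMonoidˡ record
      { isSemigroup = record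
        { isMagma = record { isEquivalence = Setoid.isEquivalence ≈-setoid ; ∙-cong = ⊕-cong }
        ; assoc   = ⊕-assoc
        }
      ; identityˡ = λ _ → ≈-refl
      ; comm      = ⊕-comm
      }
    }

  open CommSemigroupProperties (CommutativeMonoid.commutativeSemigroup ⊕-commutativeMonoid)
    using (interchange; x∙yz≈y∙xz)

  0∷-⊕ : ∀ p r → 0# ∷ (p ⊕ r) ≈ (0# ∷ p) ⊕ (0# ∷ r)
  0∷-⊕ p r = ∷-cong (sym (K.+-identityˡ 0#)) ≈-refl

  scale-cong : ∀ a {p r} → p ≈ r → scale F a p ≈ scale F a r
  scale-cong a {p} {r} p≈r = mk≈ λ i →
    trans (coeff-scale a p i) (trans (cong (a *_) (coeff-≈ p≈r i)) (sym (coeff-scale a r i)))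

  scale-distribʳ : ∀ a b p → scale F (a + b) p ≈ scale F a p ⊕ scale F b p
  scale-distribʳ a b []      = ≈-refl
  scale-distribʳ a b (c ∷ p) = ∷-cong (K.distribʳ c a b) (scale-distribʳ a b p)

  scale-distribˡ : ∀ a p r → scale F a (p ⊕ r) ≈ scale F a p ⊕ scale F a r
  scale-distribˡ a []      r       = ≈-refl
  scale-distribˡ a (b ∷ p) []      = ≈-refl
  scale-distribˡ a (b ∷ p) (c ∷ r) = ∷-cong (K.distribˡ a b c) (scale-distribˡ a p r)

  scale-assoc : ∀ a b p → scale F (a * b) p ≈ scale F a (scale F b p)
  scale-assoc a b []      = ≈-refl
  scale-assoc a b (c ∷ p) = ∷-cong (K.*-assoc a b c) (scale-assoc a b p)

  scale-zeroˡ : ∀ p → scale F 0# p ≈ []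
  scale-zeroˡ []      = ≈-refl
  scale-zeroˡ (b ∷ p) = ∷-≈[] (K.zeroˡ b) (scale-zeroˡ p)

  scale-identityˡ : ∀ p → scale F 1# p ≈ p
  scale-identityˡ []      = ≈-refl
  scale-identityˡ (b ∷ p) = ∷-cong (K.*-identityˡ b) (scale-identityˡ p)

  ⊗-congˡ : ∀ p {r r′} → r ≈ r′ → p ⊗ r ≈ p ⊗ r′
  ⊗-congˡ []      r≈r′ = ≈-refl
  ⊗-congˡ (a ∷ p) r≈r′ = ⊕-cong (scale-cong a r≈r′) (∷-cong refl (⊗-congˡ p r≈r′))

  ⊗-zeroˡ : ∀ p → [] ⊗ p ≈ []
  ⊗-zeroˡ p = ≈-refl

  ⊗-zeroʳ : ∀ p → p ⊗ [] ≈ []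
  ⊗-zeroʳ []      = ≈-refl
  ⊗-zeroʳ (a ∷ p) = ∷-≈[] refl (⊗-zeroʳ p)

  ⊗-∷ʳ : ∀ p a r → p ⊗ (a ∷ r) ≈ scale F a p ⊕ (0# ∷ p ⊗ r)
  ⊗-∷ʳ []      a r = ≈-sym (∷-≈[] refl ≈-refl)
  ⊗-∷ʳ (b ∷ p) a r = ∷-cong (cong (_+ 0#) (K.*-comm b a)) (begin
      scale F b r ⊕ p ⊗ (a ∷ r)                  ≈⟨ ⊕-cong ≈-refl (⊗-∷ʳ p a r) ⟩
      scale F b r ⊕ (scale F a p ⊕ (0# ∷ p ⊗ r))  ≈⟨ x∙yz≈y∙xz (scale F b r) (scale F a p) (0# ∷ p ⊗ r) ⟩
      scale F a p ⊕ (scale F b r ⊕ (0# ∷ p ⊗ r))  ∎)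
    where open SetoidReasoning ≈-setoid

  ⊗-comm : ∀ p r → p ⊗ r ≈ r ⊗ p
  ⊗-comm []      r = ≈-sym (⊗-zeroʳ r)
  ⊗-comm (a ∷ p) r = ≈-trans (⊕-cong ≈-refl (∷-cong refl (⊗-comm p r))) (≈-sym (⊗-∷ʳ r a p))

  ⊗-cong : ∀ {p p′ r r′} → p ≈ p′ → r ≈ r′ → p ⊗ r ≈ p′ ⊗ r′
  ⊗-cong {p} {p′} {r} {r′} p≈p′ r≈r′ = begin
    p ⊗ r   ≈⟨ ⊗-congˡ p r≈r′ ⟩
    p ⊗ r′  ≈⟨ ⊗-comm p r′ ⟩
    r′ ⊗ p  ≈⟨ ⊗-congˡ r′ p≈p′ ⟩
    r′ ⊗ p′ ≈⟨ ⊗-comm r′ p′ ⟩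
    p′ ⊗ r′ ∎
    where open SetoidReasoning ≈-setoid

  ⊗-identityˡ : ∀ p → 𝟙 ⊗ p ≈ p
  ⊗-identityˡ p = ≈-trans (⊕-cong (scale-identityˡ p) (∷-≈[] refl ≈-refl)) (⊕-identityʳ p)

  ⊗-distribʳ : ∀ r p q → (p ⊕ q) ⊗ r ≈ p ⊗ r ⊕ q ⊗ r
  ⊗-distribʳ r []      q       = ≈-refl
  ⊗-distribʳ r (a ∷ p) []      = ≈-sym (⊕-identityʳ _)
  ⊗-distribʳ r (a ∷ p) (b ∷ q) = begin
    scale F (a + b) r ⊕ (0# ∷ (p ⊕ q) ⊗ r)
      ≈⟨ ⊕-cong (scale-distribʳ a b r) (∷-cong refl (⊗-distribʳ r p q)) ⟩
    (scale F a r ⊕ scale F b r) ⊕ (0# ∷ (p ⊗ r ⊕ q ⊗ r))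
      ≈⟨ ⊕-cong ≈-refl (0∷-⊕ (p ⊗ r) (q ⊗ r)) ⟩
    (scale F a r ⊕ scale F b r) ⊕ ((0# ∷ p ⊗ r) ⊕ (0# ∷ q ⊗ r))
      ≈⟨ interchange (scale F a r) (scale F b r) (0# ∷ p ⊗ r) (0# ∷ q ⊗ r) ⟩
    (a ∷ p) ⊗ r ⊕ (b ∷ q) ⊗ r ∎
    where open SetoidReasoning ≈-setoid

  scale-⊗ : ∀ a p r → scale F a p ⊗ r ≈ scale F a (p ⊗ r)
  scale-⊗ a []      r = ≈-refl
  scale-⊗ a (b ∷ p) r = begin
    scale F (a * b) r ⊕ (0# ∷ scale F a p ⊗ r)
      ≈⟨ ⊕-cong (scale-assoc a b r) (∷-cong (sym (K.zeroʳ a)) (scale-⊗ a p r)) ⟩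
    scale F a (scale F b r) ⊕ scale F a (0# ∷ p ⊗ r)
      ≈⟨ ≈-sym (scale-distribˡ a (scale F b r) (0# ∷ p ⊗ r)) ⟩
    scale F a ((b ∷ p) ⊗ r) ∎
    where open SetoidReasoning ≈-setoid

  0∷-⊗ : ∀ p r → (0# ∷ p) ⊗ r ≈ 0# ∷ p ⊗ r
  0∷-⊗ p r = ⊕-cong (scale-zeroˡ r) ≈-refl

  ⊗-assoc : ∀ p q r → (p ⊗ q) ⊗ r ≈ p ⊗ (q ⊗ r)
  ⊗-assoc []      q r = ≈-refl
  ⊗-assoc (a ∷ p) q r = begin
    (scale F a q ⊕ (0# ∷ p ⊗ q)) ⊗ r        ≈⟨ ⊗-distribʳ r (scale F a q) (0# ∷ p ⊗ q) ⟩
    scale F a q ⊗ r ⊕ (0# ∷ p ⊗ q) ⊗ r      ≈⟨ ⊕-cong (scale-⊗ a q r) (0∷-⊗ (p ⊗ q) r) ⟩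
    scale F a (q ⊗ r) ⊕ (0# ∷ (p ⊗ q) ⊗ r)  ≈⟨ ⊕-cong ≈-refl (∷-cong refl (⊗-assoc p q r)) ⟩
    (a ∷ p) ⊗ (q ⊗ r)                       ∎
    where open SetoidReasoning ≈-setoid

  ⊗-isCommutativeMonoid : IsCommutativeMonoid _≈_ _⊗_ 𝟙
  ⊗-isCommutativeMonoid = isCommutativeMonoidˡ record
    { isSemigroup = record
      { isMagma = record { isEquivalence = Setoid.isEquivalence ≈-setoid ; ∙-cong = ⊗-cong }
      ; assoc   = ⊗-assoc
      }
    ; identityˡ = ⊗-identityˡ
    ; comm      = ⊗-comm
    }

  polynomialSemiring : CommutativeSemiring _ _
  polynomialSemiring = record
    { isCommutativeSemiring = isCommutativeSemiringˡ record
      { +-isCommutativeMonoid = CommutativeMonoid.isCommutativeMonoid ⊕-commutativeMonoid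
      ; *-isCommutativeMonoid = ⊗-isCommutativeMonoid
      ; distribʳ              = ⊗-distribʳ
      ; zeroˡ                 = ⊗-zeroˡ
      }
    }

  open CommSemigroupDivisibility (CommutativeSemiring.*-commutativeSemigroup polynomialSemiring) public
    using (_∣_; _,_)

  VanishesFrom : Poly F → ℕ → Set
  VanishesFrom p m = ∀ j → m ≤ j → coeff F p j ≡ 0#

  vanishesFrom-≈ : ∀ {p r m} → p ≈ r → VanishesFrom p m → VanishesFrom r m
  vanishesFrom-≈ p≈r p-van j m≤j = trans (sym (coeff-≈ p≈r j)) (p-van j m≤j)

  vanishesFrom-suc : ∀ {p m} → VanishesFrom p m → VanishesFrom p (suc m)
  vanishesFrom-suc p-van j m<j = p-van j (ℕ.<⇒≤ m<j)

  coeff-∷-⊗-suc : ∀ a s r j → coeff F ((a ∷ s) ⊗ r) (suc j) ≡ a * coeff F r (suc j) + coeff F (s ⊗ r) j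
  coeff-∷-⊗-suc a s r j =
    trans (coeff-⊕ (scale F a r) (0# ∷ s ⊗ r) (suc j)) (cong (_+ coeff F (s ⊗ r) j) (coeff-scale a r (suc j)))

  ∷-⊗-vanishesFrom : ∀ a s r {m} → VanishesFrom r (suc m) →
                     VanishesFrom ((a ∷ s) ⊗ r) (suc m) → VanishesFrom (s ⊗ r) m
  ∷-⊗-vanishesFrom a s r r-van as⊗r-van j m≤j = begin
    coeff F (s ⊗ r) j                            ≡⟨ sym (K.+-identityˡ _) ⟩
    0# + coeff F (s ⊗ r) j                       ≡⟨ cong (_+ coeff F (s ⊗ r) j) (sym a*r₁₊ⱼ≡0) ⟩
    a * coeff F r (suc j) + coeff F (s ⊗ r) j    ≡⟨ sym (coeff-∷-⊗-suc a s r j) ⟩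
    coeff F ((a ∷ s) ⊗ r) (suc j)                ≡⟨ as⊗r-van (suc j) (s≤s m≤j) ⟩
    0#                                           ∎
    where
    open ≡-Reasoning
    a*r₁₊ⱼ≡0 : a * coeff F r (suc j) ≡ 0#
    a*r₁₊ⱼ≡0 = trans (cong (a *_) (r-van (suc j) (s≤s m≤j))) (K.zeroʳ a)

  ∷-⊗-≈scale : ∀ {a s} r → s ≈ [] → (a ∷ s) ⊗ r ≈ scale F a r
  ∷-⊗-≈scale r s≈[] = ≈-trans (⊕-cong ≈-refl (∷-≈[] refl (⊗-cong s≈[] ≈-refl))) (⊕-identityʳ _)

  coeff-tabulate-++-< : ∀ {d} (f : Fin d → Carrier) c t → coeff F (tabulate f ++ c ∷ []) (toℕ t) ≡ f t
  coeff-tabulate-++-< f c zero    = refl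
  coeff-tabulate-++-< f c (suc t) = coeff-tabulate-++-< (λ u → f (suc u)) c t

  coeff-tabulate-++-≡ : ∀ d (f : Fin d → Carrier) c → coeff F (tabulate f ++ c ∷ []) d ≡ c
  coeff-tabulate-++-≡ zero    f c = refl
  coeff-tabulate-++-≡ (suc d) f c = coeff-tabulate-++-≡ d (λ u → f (suc u)) c

  tabulate-++-vanishesFrom : ∀ d (f : Fin d → Carrier) c → VanishesFrom (tabulate f ++ c ∷ []) (suc d)
  tabulate-++-vanishesFrom zero    f c (suc j) _         = refl
  tabulate-++-vanishesFrom (suc d) f c (suc j) (s≤s d<j) = tabulate-++-vanishesFrom d (λ u → f (suc u)) c j d<j

  module _ (g : Poly F) {d : ℕ} (g-monic : MonicOfDegree F g d) where

    private
      g-vanishes : VanishesFrom g (suc d)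
      g-vanishes = proj₂ g-monic

    coeff-scale-deg : ∀ c → coeff F (scale F c g) d ≡ c
    coeff-scale-deg c = trans (coeff-scale c g d) (trans (cong (c *_) (proj₁ g-monic)) (K.*-identityʳ c))

    ⊗-monic-vanishesFrom-deg⇒≈[] : ∀ s → VanishesFrom (s ⊗ g) d → s ≈ []
    ⊗-monic-vanishesFrom-deg⇒≈[] []      _     = ≈-refl
    ⊗-monic-vanishesFrom-deg⇒≈[] (a ∷ s) s⊗g-van = ∷-≈[] a≡0 s≈[]
      where
      s≈[] : s ≈ []
      s≈[] = ⊗-monic-vanishesFrom-deg⇒≈[] s
               (∷-⊗-vanishesFrom a s g g-vanishes (vanishesFrom-suc {(a ∷ s) ⊗ g} s⊗g-van))
      a≡0 : a ≡ 0#
      a≡0 = begin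
        a                          ≡⟨ sym (coeff-scale-deg a) ⟩
        coeff F (scale F a g) d    ≡⟨ sym (coeff-≈ (∷-⊗-≈scale g s≈[]) d) ⟩
        coeff F ((a ∷ s) ⊗ g) d    ≡⟨ s⊗g-van d ℕ.≤-refl ⟩
        0#                         ∎
        where open ≡-Reasoning

    ⊗-monic-vanishesFrom-suc-deg⇒≈scale : ∀ s → VanishesFrom (s ⊗ g) (suc d) → s ⊗ g ≈ scale F (coeff F s 0) g
    ⊗-monic-vanishesFrom-suc-deg⇒≈scale []      _       = ≈-sym (scale-zeroˡ g)
    ⊗-monic-vanishesFrom-suc-deg⇒≈scale (a ∷ s) s⊗g-van =
      ∷-⊗-≈scale g (⊗-monic-vanishesFrom-deg⇒≈[] s (∷-⊗-vanishesFrom a s g g-vanishes s⊗g-van))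

    monic∣-vanishesFrom-suc-deg⇒≈scale : ∀ {p} → g ∣ p → VanishesFrom p (suc d) → p ≈ scale F (coeff F p d) g
    monic∣-vanishesFrom-suc-deg⇒≈scale {p} (s , s⊗g≈p) p-van = begin
      p                          ≈⟨ ≈-sym s⊗g≈p ⟩
      s ⊗ g                      ≈⟨ s⊗g≈scale ⟩
      scale F (coeff F s 0) g    ≡⟨ cong (λ c → scale F c g) leading ⟩
      scale F (coeff F p d) g    ∎
      where
      open SetoidReasoning ≈-setoid
      s⊗g≈scale : s ⊗ g ≈ scale F (coeff F s 0) g
      s⊗g≈scale = ⊗-monic-vanishesFrom-suc-deg⇒≈scale s (vanishesFrom-≈ (≈-sym s⊗g≈p) p-van)
      leading : coeff F s 0 ≡ coeff F p d
      leading = trans (sym (coeff-scale-deg _)) (sym (coeff-≈ (≈-trans (≈-sym s⊗g≈p) s⊗g≈scale) d))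

    tabulate-++-≈scale : ∀ c → tabulate {n = d} (λ t → c * coeff F g (toℕ t)) ++ c ∷ [] ≈ scale F c g
    tabulate-++-≈scale c = mk≈ λ m → trans (coeff-p m) (sym (coeff-scale c g m))
      where
      f : Fin d → Carrier
      f t = c * coeff F g (toℕ t)
      p : Poly F
      p = tabulate f ++ c ∷ []
      coeff-p : ∀ m → coeff F p m ≡ c * coeff F g m
      coeff-p m with ℕ.<-cmp m d
      ... | tri< m<d _ _ = begin
        coeff F p m                        ≡⟨ cong (coeff F p) (sym (Fin.toℕ-fromℕ< m<d)) ⟩
        coeff F p (toℕ (fromℕ< m<d))       ≡⟨ coeff-tabulate-++-< f c (fromℕ< m<d) ⟩
        c * coeff F g (toℕ (fromℕ< m<d))   ≡⟨ cong (λ i → c * coeff F g i) (Fin.toℕ-fromℕ< m<d) ⟩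
        c * coeff F g m                    ∎
        where open ≡-Reasoning
      ... | tri≈ _ refl _ =
        trans (coeff-tabulate-++-≡ d f c) (sym (trans (cong (c *_) (proj₁ g-monic)) (K.*-identityʳ c)))
      ... | tri> _ _ d<m =
        trans (tabulate-++-vanishesFrom d f c m d<m) (sym (trans (cong (c *_) (g-vanishes m d<m)) (K.zeroʳ c)))

module PolynomialMatrices (F : FiniteField) where
  open ≡ using (refl; sym; cong)
  open FiniteField F
  open Polynomials F
  open Matrices polynomialSemiring

  private
    variable
      m l r : ℕ

  sumFin≡sum : (f : Fin m → Poly F) → sumFin F f ≡ sum f
  sumFin≡sum {zero}  f = refl
  sumFin≡sum {suc m} f = cong (f zero ⊕_) (sumFin≡sum (λ t → f (suc t)))

  ≈ₘ⇒≋ : {A B : PMat F m l} → _≈ₘ_ F A B → A ≋ B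
  ≈ₘ⇒≋ A≈B i j = mk≈ (A≈B i j)

  ≋⇒≈ₘ : {A B : PMat F m l} → A ≋ B → _≈ₘ_ F A B
  ≋⇒≈ₘ A≋B i j = coeff-≈ (A≋B i j)

  *ₘ≋· : (A : PMat F m l) (B : PMat F l r) → _*ₘ_ F A B ≋ A · B
  *ₘ≋· A B i j = mk≈ λ t → cong (λ p → coeff F p t) (sumFin≡sum λ u → A i u ⊗ B u j)

  idₘ-invertible : Invertible F (idₘ F m m)
  idₘ-invertible = I , I*ₘI≈I , I*ₘI≈I
    where
    I*ₘI≈I : _≈ₘ_ F (_*ₘ_ F I I) I
    I*ₘI≈I = ≋⇒≈ₘ (≋-trans (*ₘ≋· I I) (·-identityˡ I))

  equivalent-∣ₘ : ∀ {g} {P Q : PMat F m l} → Equivalent F P Q → g ∣ₘ Q → g ∣ₘ P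
  equivalent-∣ₘ {P = P} (A , B , (A′ , _ , A′A≈I) , (B′ , BB′≈I , _) , APB≈Q) =
    ∣ₘ-equivalent {A = A} {A′} {B} {B′} (≋-trans (≋-sym (*ₘ≋· A′ A)) (≈ₘ⇒≋ A′A≈I))
                  (≋-trans (≋-sym (*ₘ≋· B B′)) (≈ₘ⇒≋ BB′≈I))
                  (≋-trans (≋-sym A*ₘP*ₘB≋APB) (≈ₘ⇒≋ APB≈Q))
    where
    A*ₘP*ₘB≋APB : _*ₘ_ F (_*ₘ_ F A P) B ≋ (A · P) · B
    A*ₘP*ₘB≋APB = ≋-trans (*ₘ≋· (_*ₘ_ F A P) B) (·-congʳ B (*ₘ≋· A P))

  scale-if : ∀ b g → scale F (if b then 1# else 0#) g ≈ (if b then g else [])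
  scale-if true  g = scale-identityˡ g
  scale-if false g = scale-zeroˡ g

  module _ {n k d : ℕ} (g : Poly F) (g-monic : MonicOfDegree F g d) where

    δ : Fin n → Fin k → Carrier
    δ i j = if does (toℕ i ℕ.≟ toℕ j) then 1# else 0#

    C₀ : Coeffs F n k d
    C₀ t i j = δ i j * coeff F g (toℕ t)

    toPMat-C₀≋diag : toPMat F C₀ ≋ diagₘ F n k (λ _ → g)
    toPMat-C₀≋diag i j =
      ≈-trans (tabulate-++-≈scale g g-monic (δ i j)) (scale-if (does (toℕ i ℕ.≟ toℕ j)) g)

    C₀-invariantFactors : HasInvariantFactors F (toPMat F C₀) (λ _ → g)
    C₀-invariantFactors =
      (λ _ → d , g-monic) , (λ _ _ → 𝟙 , coeff-≈ (⊗-identityˡ g)) ,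
      (I , I , idₘ-invertible , idₘ-invertible , ≋⇒≈ₘ IPI≋diag)
      where
      P₀ : PMat F n k
      P₀ = toPMat F C₀
      IPI≋diag : _*ₘ_ F (_*ₘ_ F I P₀) I ≋ diagₘ F n k (λ _ → g)
      IPI≋diag = begin
        _*ₘ_ F (_*ₘ_ F I P₀) I  ≈⟨ *ₘ≋· (_*ₘ_ F I P₀) I ⟩
        _*ₘ_ F I P₀ · I         ≈⟨ ·-identityʳ (_*ₘ_ F I P₀) ⟩
        _*ₘ_ F I P₀             ≈⟨ *ₘ≋· I P₀ ⟩
        I · P₀                  ≈⟨ ·-identityˡ P₀ ⟩
        P₀                      ≈⟨ toPMat-C₀≋diag ⟩
        diagₘ F n k (λ _ → g)   ∎
        where open SetoidReasoning (≋-setoid n k)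

    invariantFactors⇒≡C₀ : ∀ C → HasInvariantFactors F (toPMat F C) (λ _ → g) → ∀ t i j → C t i j ≡ C₀ t i j
    invariantFactors⇒≡C₀ C (_ , _ , P~diag) t i j = begin
      C t i j                               ≡⟨ sym (coeff-tabulate-++-< (λ u → C u i j) (δ i j) t) ⟩
      coeff F (toPMat F C i j) (toℕ t)      ≡⟨ coeff-≈ entry≈δg (toℕ t) ⟩
      coeff F (scale F (δ i j) g) (toℕ t)   ≡⟨ coeff-scale (δ i j) g (toℕ t) ⟩
      C₀ t i j                              ∎
      where
      open ≡-Reasoning
      g∣entry : g ∣ toPMat F C i j
      g∣entry = equivalent-∣ₘ P~diag (∣ₘ-diag g) i j
      entry≈δg : toPMat F C i j ≈ scale F (δ i j) g
      entry≈δg = ≈-trans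
        (monic∣-vanishesFrom-suc-deg⇒≈scale g g-monic g∣entry (tabulate-++-vanishesFrom d _ _))
        (≈-reflexive (cong (λ c → scale F c g) (coeff-tabulate-++-≡ d (λ u → C u i j) (δ i j))))

corollary3p6 : (F : FiniteField) (n k d : ℕ) → 1 ≤ k → k ≤ n →
    (g : Poly F) → MonicOfDegree F g d →
    ExactlyOneWithInvFactors F n k d (λ _ → g)
corollary3p6 F n k d _ _ g g-monic =
  C₀ g g-monic , C₀-invariantFactors g g-monic , invariantFactors⇒≡C₀ g g-monic
  where open PolynomialMatrices F
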